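{- Let $A$ be a distributive meet-complemented lattice in which $\Box a$, $\Diamond a$ exist for every $a\in A$ and in which the relative meet-complement $a\to b$ exists for all $a,b\in A$. Then for all $a,b\in A$: (1) $\Box(a\to b)\le\Box a\to\Box b$; (2) $\Box(a\to b)\le\Diamond a\to\Diamond b$; (3) $\Diamond a\to\Box b\le\Box(a\to b)$.
   Context: A meet-complemented lattice is a lattice $(A,\wedge,\vee)$ such that for every $a\in A$ the element $\neg a=\max\{b\in A: a\wedge b\le c\text{ for all }c\in A\}$ exists; it is bounded, with least element $0$ and greatest element $1$. For $a,b\in A$: $\Box a=\max\{c\in A: a\vee\neg c=1\}$, $\Diamond a=\min\{c\in A: \neg a\vee c=1\}$, and $a\to b=\max\{c\in A: a\wedge c\le b\}$. -}

module Defs where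

open import Level using (Level; _⊔_)
open import Data.Product using (_×_)
open import Relation.Binary.Lattice.Bundles using (DistributiveLattice)

module _ {c ℓ₁ ℓ₂ : Level} (L : DistributiveLattice c ℓ₁ ℓ₂) where
  open DistributiveLattice L

  IsMax : {p : Level} → (Carrier → Set p) → Carrier → Set (c ⊔ ℓ₂ ⊔ p)
  IsMax P m = P m × (∀ x → P x → x ≤ m)

  IsMin : {p : Level} → (Carrier → Set p) → Carrier → Set (c ⊔ ℓ₂ ⊔ p)
  IsMin P m = P m × (∀ x → P x → m ≤ x)

  IsTop : Carrier → Set (c ⊔ ℓ₂)
  IsTop x = ∀ y → y ≤ x

  IsMeetComplement : (Carrier → Carrier) → Set (c ⊔ ℓ₂)
  IsMeetComplement neg = ∀ a → IsMax (λ b → ∀ d → (a ∧ b) ≤ d) (neg a)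

  IsBox : (Carrier → Carrier) → (Carrier → Carrier) → Set (c ⊔ ℓ₂)
  IsBox neg box = ∀ a → IsMax (λ d → IsTop (a ∨ neg d)) (box a)

  IsDiamond : (Carrier → Carrier) → (Carrier → Carrier) → Set (c ⊔ ℓ₂)
  IsDiamond neg dia = ∀ a → IsMin (λ d → IsTop (neg a ∨ d)) (dia a)

  IsRelMeetComplement : (Carrier → Carrier → Carrier) → Set (c ⊔ ℓ₂)
  IsRelMeetComplement imp = ∀ a b → IsMax (λ d → (a ∧ d) ≤ b) (imp a b)

-- Write ¬ for the meet-complement, □ and ◇ for the operators of Defs, and
-- ⇒ for the relative meet-complement.  Every argument below is a case
-- analysis along a "cover": whenever p ∨ q = 1, distributivity splits any
-- inequality x ≤ r into x ∧ p ≤ r and x ∧ q ≤ r.  The covers used are the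
-- defining ones, a ∨ ¬□a = 1 and ¬a ∨ ◇a = 1.
--
-- Two facts relate the operators:
--   □x ∧ □y ≤ □(x ∧ y)          (□ preserves meets)
--   ◇a ∧ □c ≤ ◇(a ∧ c)          (◇ absorbs □-facts)
-- and a third is the inequality (3) itself, ◇a ⇒ □b ≤ □(a ⇒ b).
-- Parts (1) and (2) follow by applying the first two to c = a ⇒ b and
-- using modus ponens a ∧ (a ⇒ b) ≤ b with monotonicity of □ and ◇.

module Submission where

open import Defs
open import Level using (Level)
open import Data.Product using (_×_; _,_; proj₁; proj₂)
open import Relation.Binary.Lattice.Bundles using (DistributiveLattice)
import Relation.Binary.Lattice.Properties.JoinSemilattice as JoinProperties
import Relation.Binary.Lattice.Properties.MeetSemilattice as MeetProperties
import Relation.Binary.Reasoning.PartialOrder as PosetReasoning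

module CoverReasoning {c ℓ₁ ℓ₂ : Level} (L : DistributiveLattice c ℓ₁ ℓ₂) where
  open DistributiveLattice L
  open PosetReasoning poset

  ≤-by-cases : ∀ {x p q r} → x ≤ p ∨ q → x ∧ p ≤ r → x ∧ q ≤ r → x ≤ r
  ≤-by-cases {x} {p} {q} {r} x≤p∨q xp≤r xq≤r = begin
    x                  ≤⟨ ∧-greatest refl x≤p∨q ⟩
    x ∧ (p ∨ q)        ≈⟨ ∧-distribˡ-∨ x p q ⟩
    (x ∧ p) ∨ (x ∧ q)  ≤⟨ ∨-least xp≤r xq≤r ⟩
    r                  ∎

  top-mono : ∀ {x y} → IsTop L x → x ≤ y → IsTop L y
  top-mono x-top x≤y w = trans (x-top w) x≤y

  top-∧-∨ : ∀ {x y n} → IsTop L (x ∨ n) → IsTop L (y ∨ n) → IsTop L ((x ∧ y) ∨ n)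
  top-∧-∨ {x} {y} {n} x∨n-top y∨n-top w =
    ≤-by-cases (x∨n-top w)
      (≤-by-cases (y∨n-top (w ∧ x))
        (trans (∧-greatest (trans (x∧y≤x _ _) (x∧y≤y _ _)) (x∧y≤y _ _)) (x≤x∨y _ _))
        (trans (x∧y≤y _ _) (y≤x∨y _ _)))
      (trans (x∧y≤y _ _) (y≤x∨y _ _))

module MeetComplement {c ℓ₁ ℓ₂ : Level} (L : DistributiveLattice c ℓ₁ ℓ₂)
  (neg : DistributiveLattice.Carrier L → DistributiveLattice.Carrier L)
  (is-neg : IsMeetComplement L neg) where
  open DistributiveLattice L
  open MeetProperties meetSemilattice using (∧-monotonic)

  neg-bot : ∀ {z d} → z ∧ neg z ≤ d
  neg-bot {z} {d} = proj₁ (is-neg z) d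

  neg-intro : ∀ {a y z} → a ∧ y ≤ z ∧ neg z → y ≤ neg a
  neg-intro {a} {y} a∧y≤⊥ = proj₂ (is-neg a) y (λ d → trans a∧y≤⊥ neg-bot)

  neg-antitone : ∀ {a b} → a ≤ b → neg b ≤ neg a
  neg-antitone a≤b = neg-intro (∧-monotonic a≤b refl)

module Box {c ℓ₁ ℓ₂ : Level} (L : DistributiveLattice c ℓ₁ ℓ₂)
  (neg box : DistributiveLattice.Carrier L → DistributiveLattice.Carrier L)
  (is-neg : IsMeetComplement L neg) (is-box : IsBox L neg box) where
  open DistributiveLattice L
  open JoinProperties joinSemilattice using (∨-monotonic)
  open CoverReasoning L
  open MeetComplement L neg is-neg

  box-top : ∀ a → IsTop L (a ∨ neg (box a))
  box-top a = proj₁ (is-box a)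

  box-intro : ∀ {a x} → IsTop L (a ∨ neg x) → x ≤ box a
  box-intro {a} {x} = proj₂ (is-box a) x

  box-mono : ∀ {a b} → a ≤ b → box a ≤ box b
  box-mono {a} a≤b = box-intro (top-mono (box-top a) (∨-monotonic a≤b refl))

  -- □ preserves binary meets: ¬(□x ∧ □y) lies above ¬□x and ¬□y, so it
  -- completes both x and y to covers, hence also x ∧ y.
  box-∧ : ∀ x y → box x ∧ box y ≤ box (x ∧ y)
  box-∧ x y = box-intro (top-∧-∨ (completes x (x∧y≤x _ _)) (completes y (x∧y≤y _ _)))
    where
    completes : ∀ z → box x ∧ box y ≤ box z → IsTop L (z ∨ neg (box x ∧ box y))
    completes z below = top-mono (box-top z) (∨-monotonic refl (neg-antitone below))

module Diamond {c ℓ₁ ℓ₂ : Level} (L : DistributiveLattice c ℓ₁ ℓ₂)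
  (neg dia : DistributiveLattice.Carrier L → DistributiveLattice.Carrier L)
  (is-neg : IsMeetComplement L neg) (is-dia : IsDiamond L neg dia) where
  open DistributiveLattice L
  open JoinProperties joinSemilattice using (∨-monotonic)
  open CoverReasoning L
  open MeetComplement L neg is-neg

  dia-top : ∀ a → IsTop L (neg a ∨ dia a)
  dia-top a = proj₁ (is-dia a)

  dia-intro : ∀ {a x} → IsTop L (neg a ∨ x) → dia a ≤ x
  dia-intro {a} {x} = proj₂ (is-dia a) x

  dia-mono : ∀ {a b} → a ≤ b → dia a ≤ dia b
  dia-mono {b = b} a≤b = dia-intro (top-mono (dia-top b) (∨-monotonic (neg-antitone a≤b) refl))

module Implication {c ℓ₁ ℓ₂ : Level} (L : DistributiveLattice c ℓ₁ ℓ₂)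
  (neg : DistributiveLattice.Carrier L → DistributiveLattice.Carrier L)
  (imp : DistributiveLattice.Carrier L → DistributiveLattice.Carrier L → DistributiveLattice.Carrier L)
  (is-neg : IsMeetComplement L neg) (is-imp : IsRelMeetComplement L imp) where
  open DistributiveLattice L
  open MeetComplement L neg is-neg

  imp-elim : ∀ {a b} → a ∧ imp a b ≤ b
  imp-elim {a} {b} = proj₁ (is-imp a b)

  imp-intro : ∀ {a b x} → a ∧ x ≤ b → x ≤ imp a b
  imp-intro {a} {b} {x} = proj₂ (is-imp a b) x

  imp-uncurry : ∀ {a b x} → x ≤ imp a b → x ∧ a ≤ b
  imp-uncurry x≤a⇒b = trans (∧-greatest (x∧y≤y _ _) (trans (x∧y≤x _ _) x≤a⇒b)) imp-elim

  consequent≤imp : ∀ {a b} → b ≤ imp a b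
  consequent≤imp = imp-intro (x∧y≤y _ _)

  neg≤imp : ∀ {a b} → neg a ≤ imp a b
  neg≤imp = imp-intro neg-bot

  ∧-neg≤neg-imp : ∀ {x y} → x ∧ neg y ≤ neg (imp x y)
  ∧-neg≤neg-imp =
    neg-intro (∧-greatest (trans (∧-greatest (trans (x∧y≤y _ _) (x∧y≤x _ _)) (x∧y≤x _ _)) imp-elim)
                          (trans (x∧y≤y _ _) (x∧y≤y _ _)))

module Modal {c ℓ₁ ℓ₂ : Level} (L : DistributiveLattice c ℓ₁ ℓ₂)
  (neg box dia : DistributiveLattice.Carrier L → DistributiveLattice.Carrier L)
  (imp : DistributiveLattice.Carrier L → DistributiveLattice.Carrier L → DistributiveLattice.Carrier L)
  (is-neg : IsMeetComplement L neg) (is-box : IsBox L neg box)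
  (is-dia : IsDiamond L neg dia) (is-imp : IsRelMeetComplement L imp) where
  open DistributiveLattice L
  open CoverReasoning L
  open MeetComplement L neg is-neg
  open Box L neg box is-neg is-box
  open Diamond L neg dia is-neg is-dia
  open Implication L neg imp is-neg is-imp

  -- ◇a ∧ □c ≤ ◇(a ∧ c).  By minimality of ◇a it suffices that
  -- ¬a ∨ (□c ⇒ ◇(a ∧ c)) = 1, checked along the covers c ∨ ¬□c and
  -- ¬(a ∧ c) ∨ ◇(a ∧ c).
  dia-∧-box : ∀ a c → dia a ∧ box c ≤ dia (a ∧ c)
  dia-∧-box a c = imp-uncurry (dia-intro cover)
    where
    target = neg a ∨ imp (box c) (dia (a ∧ c))

    refutes-a : ∀ w → a ∧ ((w ∧ c) ∧ neg (a ∧ c)) ≤ (a ∧ c) ∧ neg (a ∧ c)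
    refutes-a w = ∧-greatest (∧-greatest (x∧y≤x _ _) (trans (x∧y≤y _ _) (trans (x∧y≤x _ _) (x∧y≤y _ _))))
                             (trans (x∧y≤y _ _) (x∧y≤y _ _))

    cover : IsTop L target
    cover w = ≤-by-cases (box-top c w)
      (≤-by-cases (dia-top (a ∧ c) (w ∧ c))
        (trans (neg-intro (refutes-a w)) (x≤x∨y _ _))
        (trans (x∧y≤y _ _) (trans consequent≤imp (y≤x∨y _ _))))
      (trans (x∧y≤y _ _) (trans neg≤imp (y≤x∨y _ _)))

  -- ◇a ⇒ □b ≤ □(a ⇒ b).  By maximality of □ it suffices that
  -- (a ⇒ b) ∨ ¬(◇a ⇒ □b) = 1, checked along the covers ¬a ∨ ◇a and b ∨ ¬□b.
  dia-imp-box : ∀ a b → imp (dia a) (box b) ≤ box (imp a b)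
  dia-imp-box a b = box-intro cover
    where
    cover : IsTop L (imp a b ∨ neg (imp (dia a) (box b)))
    cover w = ≤-by-cases (dia-top a w)
      (trans (x∧y≤y _ _) (trans neg≤imp (x≤x∨y _ _)))
      (≤-by-cases (box-top b (w ∧ dia a))
        (trans (x∧y≤y _ _) (trans consequent≤imp (x≤x∨y _ _)))
        (trans (∧-greatest (trans (x∧y≤x _ _) (x∧y≤y _ _)) (x∧y≤y _ _))
               (trans ∧-neg≤neg-imp (y≤x∨y _ _))))

proposition27 : {c ℓ₁ ℓ₂ : Level} (L : DistributiveLattice c ℓ₁ ℓ₂)
    → let open DistributiveLattice L in
    (neg box dia : Carrier → Carrier) (imp : Carrier → Carrier → Carrier)
    → IsMeetComplement L neg
    → IsBox L neg box
    → IsDiamond L neg dia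
    → IsRelMeetComplement L imp
    → ∀ a b
    → (box (imp a b) ≤ imp (box a) (box b))
    × (box (imp a b) ≤ imp (dia a) (dia b))
    × (imp (dia a) (box b) ≤ box (imp a b))
proposition27 L neg box dia imp is-neg is-box is-dia is-imp a b =
  imp-intro (trans (box-∧ a (imp a b)) (box-mono imp-elim)) ,
  imp-intro (trans (dia-∧-box a (imp a b)) (dia-mono imp-elim)) ,
  dia-imp-box a b
  where
  open DistributiveLattice L using (trans)
  open Box L neg box is-neg is-box
  open Diamond L neg dia is-neg is-dia
  open Implication L neg imp is-neg is-imp
  open Modal L neg box dia imp is-neg is-box is-dia is-imp
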